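{- Consider the epoch-based binary search process and its coupled process $W$ described in the context. Let $\tau$ be the step at which an epoch of length $k$ starts, and assume $k\le K\varepsilon^{ -2}$ for a constant $K$. Then, conditionally on the history up to step $\tau$, $$\mathbb{E}[W_{\tau+k}]\le\frac{1}{2^k}\left(1+\mathcal{O}(\varepsilon^4k^2)\right)W_\tau,$$ where the constant in $\mathcal{O}$ depends only on $K$.
   Context: Noisy binary search over a finite linearly ordered set $V$ with unknown target $v^*$; a query to element $q$ has a correct reply "$<$" or "$>$" indicating on which side of $q$ the target lies, and each reply is independently flipped with probability $p=\frac12-\varepsilon$, $0<\varepsilon<\frac12$. The process keeps weights $\omega_t(v)\ge0$, $\omega(U)=\sum_{u\in U}\omega(u)$, and after each query performs a Bayesian update (weights of elements consistent with the reply multiplied by $1-p$, others by $p$). Queries are organized in epochs of predetermined lengths; a set $M$ of marked elements is initially empty. At the start of an epoch the process picks an unmarked central element $q$ with $\omega(\{v<q\}\setminus M)\le\frac12\omega(V\setminus M)$ and $\omega(\{v>q\}\setminus M)\le\frac12\omega(V\setminus M)$, queries $q$ repeatedly for the whole epoch, and at the end of the epoch adds $q$ to $M$. Coupled process: $W_0=\omega_0(V)$, and for an epoch of length $k$ starting at step $\tau$ during which $x$ "$<$"-answers and $y$ "$>$"-answers occurred ($x+y=k$), $W_{\tau+k}=W_\tau\frac{(1-p)^xp^y+(1-p)^yp^x}{2}$.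
   Formalization: The noise bias ε, the constant K and the coupled weight $W_\tau$ range over the rationals. -}

module Defs where

open import Data.Bool using (Bool; true; false; if_then_else_)
open import Data.Nat as ℕ using (ℕ; zero; suc)
open import Data.Integer using (+_)
open import Data.List using (List; []; _∷_; map; _++_; foldr)
open import Data.Vec using (Vec; []; _∷_)
open import Data.Rational using (ℚ; _+_; _*_; _-_; ½; 0ℚ; 1ℚ; _/_)

ℕtoℚ : ℕ → ℚ
ℕtoℚ n = + n / 1

_^_ : ℚ → ℕ → ℚ
q ^ zero  = 1ℚ
q ^ suc n = q * (q ^ n)

infixr 8 _^_

-- A reply is a Bool: true = "<", false = ">".
Reply : Set
Reply = Bool

allReplies : (k : ℕ) → List (Vec Reply k)
allReplies zero    = [] ∷ []
allReplies (suc k) = map (true ∷_) (allReplies k) ++ map (false ∷_) (allReplies k)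

sumℚ : List ℚ → ℚ
sumℚ = foldr _+_ 0ℚ

countLt : ∀ {k} → Vec Reply k → ℕ
countLt []            = 0
countLt (true  ∷ s)   = suc (countLt s)
countLt (false ∷ s)   = countLt s

countGt : ∀ {k} → Vec Reply k → ℕ
countGt []            = 0
countGt (true  ∷ s)   = countGt s
countGt (false ∷ s)   = suc (countGt s)

-- Probability of a reply sequence when the correct reply is c and each
-- reply is independently flipped with probability p.
seqProb : (p : ℚ) (c : Reply) → ∀ {k} → Vec Reply k → ℚ
seqProb p c []      = 1ℚ
seqProb p c (r ∷ s) = (if r Data.Bool.xor c then p else (1ℚ - p)) * seqProb p c s
  where import Data.Bool

coupledUpdate : (p W : ℚ) → ∀ {k} → Vec Reply k → ℚ
coupledUpdate p W s =
  W * (((1ℚ - p) ^ countLt s * p ^ countGt s + (1ℚ - p) ^ countGt s * p ^ countLt s) * ½)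

-- Conditional expectation of W_{τ+k} given the history up to τ
-- (which fixes W_τ = W and the correct reply c to the central query q).
expectedW : (p : ℚ) (c : Reply) (W : ℚ) (k : ℕ) → ℚ
expectedW p c W k = sumℚ (map (λ s → seqProb p c s * coupledUpdate p W s) (allReplies k))

{-# OPTIONS --safe #-}
module Submission where

-- Summing over the 2^k reply sequences, the product structure of seqProb and of the coupled update
-- gives, whichever reply is correct,
--   E[W_{τ+k}] = 2^-k · ½((1 + a)^k + (1 - a)^k) · W_τ,   a = 4ε².
-- Inducting jointly on the even and odd parts of (1 ± a)^j, the even part ½((1 + a)^k + (1 - a)^k)
-- is at most 1 + ½Ma²k² as soon as (1 + a)^k ≤ M. Such an M depends on K alone: (1 + a)^k is at
-- most (1 + ε²)^4k, and cutting these 4k factors into 16(N + 1) blocks, where K ≤ N, makes each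
-- block short enough for Bernoulli's inequality to bound it by 2.

open import Defs
open import Algebra.Bundles using (CommutativeMonoid)
import Algebra.Properties.CommutativeSemigroup as CommutativeSemigroupProperties
open import Data.Bool using (Bool; true; false)
import Data.Integer as ℤ
import Data.Integer.Properties as ℤP
open import Data.List using (List; []; _∷_; map; _++_)
open import Data.List.Properties using (map-++; map-∘; map-cong)
open import Data.Nat as ℕ using (ℕ; zero; suc; z≤n; s≤s)
import Data.Nat.Coprimality as Coprime
open import Data.Nat.DivMod using (m≡m%n+[m/n]*n; m%n≤n; m/n*n≤m)
import Data.Nat.Properties as ℕP
open import Data.Product using (∃; _,_)
open import Data.Rational
  using (ℚ; mkℚ; _+_; _*_; _-_; -_; _/_; _≤_; _<_; ½; 0ℚ; 1ℚ; *≤*; Positive; nonNegative)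
import Data.Rational.Properties as ℚP
open ℚP using (≤-refl; ≤-trans; ≤-reflexive; +-mono-≤; <⇒≤)
open import Data.Rational.Solver using (module +-*-Solver)
open +-*-Solver using (solve; _:+_; _:*_; _:-_; _:=_; con)
open import Data.Vec using (Vec; []; _∷_)
open import Relation.Binary.PropositionalEquality
  using (_≡_; refl; sym; trans; cong; cong₂; subst; subst₂; module ≡-Reasoning)

module +-Comm = CommutativeSemigroupProperties (CommutativeMonoid.commutativeSemigroup ℚP.+-0-commutativeMonoid)
module *-Comm = CommutativeSemigroupProperties (CommutativeMonoid.commutativeSemigroup ℚP.*-1-commutativeMonoid)

2ℚ ¼ : ℚ
2ℚ = 1ℚ + 1ℚ
¼ = ½ * ½

0≤1 : 0ℚ ≤ 1ℚ
0≤1 = ℚP.nonNegative⁻¹ 1ℚ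

0≤2 : 0ℚ ≤ 2ℚ
0≤2 = +-mono-≤ 0≤1 0≤1

0≤½ : 0ℚ ≤ ½
0≤½ = ℚP.nonNegative⁻¹ ½

*-monoˡ-≤ : ∀ {r p q} → 0ℚ ≤ r → p ≤ q → r * p ≤ r * q
*-monoˡ-≤ {r} 0≤r = ℚP.*-monoˡ-≤-nonNeg r {{nonNegative 0≤r}}

*-monoʳ-≤ : ∀ {r p q} → 0ℚ ≤ r → p ≤ q → p * r ≤ q * r
*-monoʳ-≤ {r} 0≤r = ℚP.*-monoʳ-≤-nonNeg r {{nonNegative 0≤r}}

*-mono-≤ : ∀ {p q r s} → 0ℚ ≤ p → 0ℚ ≤ r → p ≤ q → r ≤ s → p * r ≤ q * s
*-mono-≤ 0≤p 0≤r p≤q r≤s = ≤-trans (*-monoʳ-≤ 0≤r p≤q) (*-monoˡ-≤ (≤-trans 0≤p p≤q) r≤s)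

*-nonNeg : ∀ {p q} → 0ℚ ≤ p → 0ℚ ≤ q → 0ℚ ≤ p * q
*-nonNeg = *-mono-≤ ≤-refl ≤-refl

p≤p+q : ∀ {p q} → 0ℚ ≤ q → p ≤ p + q
p≤p+q {p} 0≤q = ≤-trans (≤-reflexive (sym (ℚP.+-identityʳ p))) (ℚP.+-monoʳ-≤ p 0≤q)

p-q≤p : ∀ {p q} → 0ℚ ≤ q → p - q ≤ p
p-q≤p {p} 0≤q = ≤-trans (ℚP.+-monoʳ-≤ p (ℚP.neg-antimono-≤ 0≤q)) (≤-reflexive (ℚP.+-identityʳ p))

^-nonNeg : ∀ {x} → 0ℚ ≤ x → ∀ k → 0ℚ ≤ x ^ k
^-nonNeg 0≤x zero    = 0≤1
^-nonNeg 0≤x (suc k) = *-nonNeg 0≤x (^-nonNeg 0≤x k)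

^-monoˡ-≤ : ∀ {x y} → 0ℚ ≤ x → x ≤ y → ∀ k → x ^ k ≤ y ^ k
^-monoˡ-≤ 0≤x x≤y zero    = ≤-refl
^-monoˡ-≤ 0≤x x≤y (suc k) = *-mono-≤ 0≤x (^-nonNeg 0≤x k) x≤y (^-monoˡ-≤ 0≤x x≤y k)

1≤^ : ∀ {x} → 1ℚ ≤ x → ∀ k → 1ℚ ≤ x ^ k
1≤^ 1≤x zero    = ≤-refl
1≤^ 1≤x (suc k) = *-mono-≤ 0≤1 0≤1 1≤x (1≤^ 1≤x k)

^-monoʳ-≤ : ∀ {x m n} → 1ℚ ≤ x → m ℕ.≤ n → x ^ m ≤ x ^ n
^-monoʳ-≤ 1≤x (z≤n {n}) = 1≤^ 1≤x n
^-monoʳ-≤ 1≤x (s≤s m≤n) = *-monoˡ-≤ (≤-trans 0≤1 1≤x) (^-monoʳ-≤ 1≤x m≤n)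

^-distribˡ-+-* : ∀ x m n → x ^ (m ℕ.+ n) ≡ x ^ m * x ^ n
^-distribˡ-+-* x zero    n = sym (ℚP.*-identityˡ (x ^ n))
^-distribˡ-+-* x (suc m) n = trans (cong (x *_) (^-distribˡ-+-* x m n)) (sym (ℚP.*-assoc x _ _))

^-*-assoc : ∀ x m n → (x ^ m) ^ n ≡ x ^ (m ℕ.* n)
^-*-assoc x m zero    = cong (x ^_) (sym (ℕP.*-zeroʳ m))
^-*-assoc x m (suc n) = begin
  x ^ m * (x ^ m) ^ n    ≡⟨ cong (x ^ m *_) (^-*-assoc x m n) ⟩
  x ^ m * x ^ (m ℕ.* n)  ≡⟨ ^-distribˡ-+-* x m (m ℕ.* n) ⟨
  x ^ (m ℕ.+ m ℕ.* n)    ≡⟨ cong (x ^_) (ℕP.*-suc m n) ⟨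
  x ^ (m ℕ.* suc n)      ∎
  where open ≡-Reasoning

^-distribʳ-* : ∀ x y k → (x * y) ^ k ≡ x ^ k * y ^ k
^-distribʳ-* x y zero    = refl
^-distribʳ-* x y (suc k) =
  trans (cong (x * y *_) (^-distribʳ-* x y k)) (*-Comm.interchange x y (x ^ k) (y ^ k))

ℕtoℚ-suc : ∀ n → ℕtoℚ (suc n) ≡ 1ℚ + ℕtoℚ n
ℕtoℚ-suc n = begin
  (ℤ.+ suc n) / 1                            ≡⟨ ℚP./-cong (cong (ℤ._+_ ℤ.1ℤ) (sym (ℤP.*-identityʳ (ℤ.+ n)))) refl ⟩
  -- definitionally 1ℚ + mkℚ (ℤ.+ n) 0 _, by the definition of _+_ on ℚ
  (ℤ.1ℤ ℤ.* ℤ.1ℤ ℤ.+ (ℤ.+ n) ℤ.* ℤ.1ℤ) / 1    ≡⟨ cong (1ℚ +_) (sym (ℚP.normalize-coprime n/1-coprime)) ⟩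
  1ℚ + ℕtoℚ n                                ∎
  where
  open ≡-Reasoning
  n/1-coprime = Coprime.sym (Coprime.1-coprimeTo n)

ℕtoℚ-+ : ∀ m n → ℕtoℚ (m ℕ.+ n) ≡ ℕtoℚ m + ℕtoℚ n
ℕtoℚ-+ zero    n = sym (ℚP.+-identityˡ (ℕtoℚ n))
ℕtoℚ-+ (suc m) n = begin
  ℕtoℚ (suc (m ℕ.+ n))       ≡⟨ ℕtoℚ-suc (m ℕ.+ n) ⟩
  1ℚ + ℕtoℚ (m ℕ.+ n)        ≡⟨ cong (1ℚ +_) (ℕtoℚ-+ m n) ⟩
  1ℚ + (ℕtoℚ m + ℕtoℚ n)     ≡⟨ ℚP.+-assoc 1ℚ (ℕtoℚ m) (ℕtoℚ n) ⟨
  (1ℚ + ℕtoℚ m) + ℕtoℚ n     ≡⟨ cong (_+ ℕtoℚ n) (ℕtoℚ-suc m) ⟨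
  ℕtoℚ (suc m) + ℕtoℚ n      ∎
  where open ≡-Reasoning

ℕtoℚ-* : ∀ m n → ℕtoℚ (m ℕ.* n) ≡ ℕtoℚ m * ℕtoℚ n
ℕtoℚ-* zero    n = sym (ℚP.*-zeroˡ (ℕtoℚ n))
ℕtoℚ-* (suc m) n = begin
  ℕtoℚ (n ℕ.+ m ℕ.* n)         ≡⟨ ℕtoℚ-+ n (m ℕ.* n) ⟩
  ℕtoℚ n + ℕtoℚ (m ℕ.* n)      ≡⟨ cong (ℕtoℚ n +_) (ℕtoℚ-* m n) ⟩
  ℕtoℚ n + ℕtoℚ m * ℕtoℚ n     ≡⟨ distrib (ℕtoℚ m) (ℕtoℚ n) ⟩
  (1ℚ + ℕtoℚ m) * ℕtoℚ n       ≡⟨ cong (_* ℕtoℚ n) (ℕtoℚ-suc m) ⟨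
  ℕtoℚ (suc m) * ℕtoℚ n        ∎
  where
  open ≡-Reasoning
  distrib : ∀ a b → b + a * b ≡ (1ℚ + a) * b
  distrib = solve 2 (λ a b → b :+ a :* b := (con 1ℚ :+ a) :* b) refl

ℕtoℚ-nonNeg : ∀ n → 0ℚ ≤ ℕtoℚ n
ℕtoℚ-nonNeg zero    = ≤-refl
ℕtoℚ-nonNeg (suc n) = subst (0ℚ ≤_) (sym (ℕtoℚ-suc n)) (+-mono-≤ 0≤1 (ℕtoℚ-nonNeg n))

ℕtoℚ-mono-≤ : ∀ {m n} → m ℕ.≤ n → ℕtoℚ m ≤ ℕtoℚ n
ℕtoℚ-mono-≤ (z≤n {n})         = ℕtoℚ-nonNeg n
ℕtoℚ-mono-≤ (s≤s {m} {n} m≤n) =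
  subst₂ _≤_ (sym (ℕtoℚ-suc m)) (sym (ℕtoℚ-suc n)) (ℚP.+-monoʳ-≤ 1ℚ (ℕtoℚ-mono-≤ m≤n))

ℕtoℚ-pos : ∀ n .{{_ : ℕ.NonZero n}} → Positive (ℕtoℚ n)
ℕtoℚ-pos (suc n) = subst Positive (sym (ℕtoℚ-suc n))
  (ℚP.pos+nonNeg⇒pos 1ℚ (ℕtoℚ n) {{nonNegative (ℕtoℚ-nonNeg n)}})

ℕtoℚ-unbounded : ∀ p → ∃ λ N → p ≤ ℕtoℚ N
ℕtoℚ-unbounded p@(mkℚ ℤ.-[1+ _ ] _ _) = 0 , <⇒≤ (ℚP.negative⁻¹ p)
ℕtoℚ-unbounded p@(mkℚ (ℤ.+ n) _ _)    = n , subst (p ≤_) (sym n/1≡mkℚ)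
  (*≤* (ℤP.*-monoˡ-≤-nonNeg (ℤ.+ n) (ℤ.+≤+ (s≤s z≤n))))
  where
  n/1≡mkℚ : ℕtoℚ n ≡ mkℚ (ℤ.+ n) 0 _
  n/1≡mkℚ = ℚP.normalize-coprime (Coprime.sym (Coprime.1-coprimeTo n))

1+mx≤[1+x]^m : ∀ {x} → 0ℚ ≤ x → ∀ m → 1ℚ + ℕtoℚ m * x ≤ (1ℚ + x) ^ m
1+mx≤[1+x]^m {x} 0≤x zero    = ≤-reflexive (cong (1ℚ +_) (ℚP.*-zeroˡ x))
1+mx≤[1+x]^m {x} 0≤x (suc m) = begin
  1ℚ + ℕtoℚ (suc m) * x                 ≡⟨ cong (λ t → 1ℚ + t * x) (ℕtoℚ-suc m) ⟩
  1ℚ + (1ℚ + B) * x                     ≤⟨ p≤p+q (*-nonNeg (ℕtoℚ-nonNeg m) (*-nonNeg 0≤x 0≤x)) ⟩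
  1ℚ + (1ℚ + B) * x + B * (x * x)       ≡⟨ factor x B ⟩
  (1ℚ + x) * (1ℚ + B * x)               ≤⟨ *-monoˡ-≤ (+-mono-≤ 0≤1 0≤x) (1+mx≤[1+x]^m 0≤x m) ⟩
  (1ℚ + x) * (1ℚ + x) ^ m               ∎
  where
  open ℚP.≤-Reasoning
  B = ℕtoℚ m
  factor : ∀ x B → 1ℚ + (1ℚ + B) * x + B * (x * x) ≡ (1ℚ + x) * (1ℚ + B * x)
  factor = solve 2 (λ x B →
    con 1ℚ :+ (con 1ℚ :+ B) :* x :+ B :* (x :* x) := (con 1ℚ :+ x) :* (con 1ℚ :+ B :* x)) refl

[1+x]^m*[1-mx]≤1 : ∀ {x} → 0ℚ ≤ x → ∀ m → (1ℚ + x) ^ m * (1ℚ - ℕtoℚ m * x) ≤ 1ℚ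
[1+x]^m*[1-mx]≤1 {x} 0≤x zero    =
  ≤-reflexive (trans (ℚP.*-identityˡ _) (cong (λ t → 1ℚ - t) (ℚP.*-zeroˡ x)))
[1+x]^m*[1-mx]≤1 {x} 0≤x (suc m) = begin
  (1ℚ + x) * X * (1ℚ - ℕtoℚ (suc m) * x)        ≡⟨ cong (λ t → (1ℚ + x) * X * (1ℚ - t * x)) (ℕtoℚ-suc m) ⟩
  (1ℚ + x) * X * (1ℚ - (1ℚ + B) * x)            ≡⟨ expand x X B ⟩
  X * (1ℚ - B * x) - X * ((1ℚ + B) * (x * x))   ≤⟨ p-q≤p (*-nonNeg (^-nonNeg 0≤1+x m) 0≤[1+B]x²) ⟩
  X * (1ℚ - B * x)                              ≤⟨ [1+x]^m*[1-mx]≤1 0≤x m ⟩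
  1ℚ                                            ∎
  where
  open ℚP.≤-Reasoning
  X = (1ℚ + x) ^ m
  B = ℕtoℚ m
  0≤1+x = +-mono-≤ 0≤1 0≤x
  0≤[1+B]x² = *-nonNeg (+-mono-≤ 0≤1 (ℕtoℚ-nonNeg m)) (*-nonNeg 0≤x 0≤x)
  expand : ∀ x X B → (1ℚ + x) * X * (1ℚ - (1ℚ + B) * x) ≡ X * (1ℚ - B * x) - X * ((1ℚ + B) * (x * x))
  expand = solve 3 (λ x X B →
    (con 1ℚ :+ x) :* X :* (con 1ℚ :- (con 1ℚ :+ B) :* x)
      := X :* (con 1ℚ :- B :* x) :- X :* ((con 1ℚ :+ B) :* (x :* x))) refl

[1+x]^m≤2 : ∀ {x} → 0ℚ ≤ x → ∀ m → ℕtoℚ m * x ≤ ½ → (1ℚ + x) ^ m ≤ 2ℚ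
[1+x]^m≤2 {x} 0≤x m mx≤½ = begin
  X                              ≡⟨ halve X ⟩
  X * ½ * 2ℚ                     ≤⟨ *-monoʳ-≤ 0≤2 (*-monoˡ-≤ (^-nonNeg (+-mono-≤ 0≤1 0≤x) m) ½≤1-mx) ⟩
  X * (1ℚ - ℕtoℚ m * x) * 2ℚ     ≤⟨ *-monoʳ-≤ 0≤2 ([1+x]^m*[1-mx]≤1 0≤x m) ⟩
  1ℚ * 2ℚ                        ∎
  where
  open ℚP.≤-Reasoning
  X = (1ℚ + x) ^ m
  halve : ∀ X → X ≡ X * ½ * 2ℚ
  halve = solve 1 (λ X → X := X :* con ½ :* con 2ℚ) refl
  ½≤1-mx : ½ ≤ 1ℚ - ℕtoℚ m * x
  ½≤1-mx = ℚP.+-monoʳ-≤ 1ℚ (ℚP.neg-antimono-≤ mx≤½)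

[m/n]*x≤y : ∀ {x y} → 0ℚ ≤ x → ∀ m n .{{_ : ℕ.NonZero n}} →
  ℕtoℚ m * x ≤ ℕtoℚ n * y → ℕtoℚ (m ℕ./ n) * x ≤ y
[m/n]*x≤y {x} {y} 0≤x m n mx≤ny = ℚP.*-cancelˡ-≤-pos N {{ℕtoℚ-pos n}} (begin
  N * (ℕtoℚ d * x)        ≡⟨ *-Comm.x∙yz≈yx∙z N (ℕtoℚ d) x ⟩
  ℕtoℚ d * N * x          ≡⟨ cong (_* x) (ℕtoℚ-* d n) ⟨
  ℕtoℚ (d ℕ.* n) * x      ≤⟨ *-monoʳ-≤ 0≤x (ℕtoℚ-mono-≤ (m/n*n≤m m n)) ⟩
  ℕtoℚ m * x              ≤⟨ mx≤ny ⟩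
  N * y                   ∎)
  where
  open ℚP.≤-Reasoning
  N = ℕtoℚ n
  d = m ℕ./ n

[1+x]^k≤2^n : ∀ {x} → 0ℚ ≤ x → x ≤ ¼ → ∀ k n .{{_ : ℕ.NonZero n}} →
  ℕtoℚ k * x ≤ ℕtoℚ n * ¼ → (1ℚ + x) ^ k ≤ 2ℚ ^ n
[1+x]^k≤2^n {x} 0≤x x≤¼ k n kx≤n¼ = begin
  (1ℚ + x) ^ k          ≤⟨ ^-monoʳ-≤ (p≤p+q 0≤x) k≤ℓ*n ⟩
  (1ℚ + x) ^ (ℓ ℕ.* n)  ≡⟨ ^-*-assoc (1ℚ + x) ℓ n ⟨
  ((1ℚ + x) ^ ℓ) ^ n    ≤⟨ ^-monoˡ-≤ (^-nonNeg (+-mono-≤ 0≤1 0≤x) ℓ) ([1+x]^m≤2 0≤x ℓ ℓx≤½) n ⟩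
  2ℚ ^ n                ∎
  where
  open ℚP.≤-Reasoning
  d = k ℕ./ n
  ℓ = suc d
  k≤ℓ*n : k ℕ.≤ ℓ ℕ.* n
  k≤ℓ*n = ℕP.≤-trans (ℕP.≤-reflexive (m≡m%n+[m/n]*n k n)) (ℕP.+-monoˡ-≤ (d ℕ.* n) (m%n≤n k n))
  distrib : ∀ a b → (1ℚ + a) * b ≡ b + a * b
  distrib = solve 2 (λ a b → (con 1ℚ :+ a) :* b := b :+ a :* b) refl
  ℓx≤½ : ℕtoℚ ℓ * x ≤ ½
  ℓx≤½ = begin
    ℕtoℚ ℓ * x          ≡⟨ cong (_* x) (ℕtoℚ-suc d) ⟩
    (1ℚ + ℕtoℚ d) * x   ≡⟨ distrib (ℕtoℚ d) x ⟩
    x + ℕtoℚ d * x      ≤⟨ +-mono-≤ x≤¼ ([m/n]*x≤y 0≤x k n kx≤n¼) ⟩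
    ¼ + ¼               ∎

[1+4x]^k≤2^[16*[1+N]] : ∀ {x} → 0ℚ ≤ x → x ≤ ¼ → ∀ k N → ℕtoℚ k * x ≤ ℕtoℚ N →
  (1ℚ + 2ℚ * 2ℚ * x) ^ k ≤ 2ℚ ^ (16 ℕ.* suc N)
[1+4x]^k≤2^[16*[1+N]] {x} 0≤x x≤¼ k N kx≤N = begin
  (1ℚ + 2ℚ * 2ℚ * x) ^ k  ≤⟨ ^-monoˡ-≤ 0≤1+4x (1+mx≤[1+x]^m 0≤x 4) k ⟩
  ((1ℚ + x) ^ 4) ^ k      ≡⟨ ^-*-assoc (1ℚ + x) 4 k ⟩
  (1ℚ + x) ^ (4 ℕ.* k)    ≤⟨ [1+x]^k≤2^n 0≤x x≤¼ (4 ℕ.* k) (16 ℕ.* suc N) 4kx≤n¼ ⟩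
  2ℚ ^ (16 ℕ.* suc N)     ∎
  where
  open ℚP.≤-Reasoning
  0≤1+4x = +-mono-≤ 0≤1 (*-nonNeg (*-nonNeg 0≤2 0≤2) 0≤x)
  scale : ∀ y → ℕtoℚ 4 * y ≡ ℕtoℚ 16 * y * ¼
  scale = solve 1 (λ y → con (ℕtoℚ 4) :* y := con (ℕtoℚ 16) :* y :* con ¼) refl
  4kx≤n¼ : ℕtoℚ (4 ℕ.* k) * x ≤ ℕtoℚ (16 ℕ.* suc N) * ¼
  4kx≤n¼ = begin
    ℕtoℚ (4 ℕ.* k) * x             ≡⟨ cong (_* x) (ℕtoℚ-* 4 k) ⟩
    ℕtoℚ 4 * ℕtoℚ k * x            ≡⟨ ℚP.*-assoc (ℕtoℚ 4) (ℕtoℚ k) x ⟩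
    ℕtoℚ 4 * (ℕtoℚ k * x)          ≤⟨ *-monoˡ-≤ (ℕtoℚ-nonNeg 4) (≤-trans kx≤N (ℕtoℚ-mono-≤ (ℕP.n≤1+n N))) ⟩
    ℕtoℚ 4 * ℕtoℚ (suc N)          ≡⟨ scale (ℕtoℚ (suc N)) ⟩
    ℕtoℚ 16 * ℕtoℚ (suc N) * ¼     ≡⟨ cong (_* ¼) (ℕtoℚ-* 16 (suc N)) ⟨
    ℕtoℚ (16 ℕ.* suc N) * ¼        ∎

module _ {a M : ℚ} (0≤a : 0ℚ ≤ a) (a≤1 : a ≤ 1ℚ) where

  private
    0≤1+a : 0ℚ ≤ 1ℚ + a
    0≤1+a = +-mono-≤ 0≤1 0≤a

    0≤1-a : 0ℚ ≤ 1ℚ - a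
    0≤1-a = ≤-trans (≤-reflexive (sym (ℚP.+-inverseʳ a))) (ℚP.+-monoˡ-≤ (- a) a≤1)

    [1-a]^j≤[1+a]^j : ∀ j → (1ℚ - a) ^ j ≤ (1ℚ + a) ^ j
    [1-a]^j≤[1+a]^j = ^-monoˡ-≤ 0≤1-a (≤-trans (p-q≤p {p = 1ℚ} 0≤a) (p≤p+q 0≤a))

    [1+a]^j≤M : ∀ j → (1ℚ + a) ^ suc j ≤ M → (1ℚ + a) ^ j ≤ M
    [1+a]^j≤M j = ≤-trans (^-monoʳ-≤ (p≤p+q 0≤a) (ℕP.n≤1+n j))

  [1+a]^j-[1-a]^j≤2Maj : ∀ j → (1ℚ + a) ^ j ≤ M → (1ℚ + a) ^ j - (1ℚ - a) ^ j ≤ 2ℚ * M * a * ℕtoℚ j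
  [1+a]^j-[1-a]^j≤2Maj zero    _      = ≤-reflexive (sym (ℚP.*-zeroʳ (2ℚ * M * a)))
  [1+a]^j-[1-a]^j≤2Maj (suc j) u′≤M = begin
    (1ℚ + a) * u - (1ℚ - a) * v   ≡⟨ step a u v ⟩
    (u - v) + a * (u + v)         ≤⟨ +-mono-≤ ([1+a]^j-[1-a]^j≤2Maj j u≤M) (*-monoˡ-≤ 0≤a u+v≤M+M) ⟩
    2ℚ * M * a * J + a * (M + M)  ≡⟨ collect a M J ⟩
    2ℚ * M * a * (1ℚ + J)         ≡⟨ cong (2ℚ * M * a *_) (ℕtoℚ-suc j) ⟨
    2ℚ * M * a * ℕtoℚ (suc j)     ∎
    where
    open ℚP.≤-Reasoning
    u = (1ℚ + a) ^ j
    v = (1ℚ - a) ^ j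
    J = ℕtoℚ j
    u≤M = [1+a]^j≤M j u′≤M
    u+v≤M+M = +-mono-≤ u≤M (≤-trans ([1-a]^j≤[1+a]^j j) u≤M)
    step : ∀ a u v → (1ℚ + a) * u - (1ℚ - a) * v ≡ (u - v) + a * (u + v)
    step = solve 3 (λ a u v → (con 1ℚ :+ a) :* u :- (con 1ℚ :- a) :* v := (u :- v) :+ a :* (u :+ v)) refl
    collect : ∀ a M J → 2ℚ * M * a * J + a * (M + M) ≡ 2ℚ * M * a * (1ℚ + J)
    collect = solve 3 (λ a M J →
      con 2ℚ :* M :* a :* J :+ a :* (M :+ M) := con 2ℚ :* M :* a :* (con 1ℚ :+ J)) refl

  [1+a]^j+[1-a]^j≤2+Ma²j² : ∀ j → (1ℚ + a) ^ j ≤ M →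
    (1ℚ + a) ^ j + (1ℚ - a) ^ j ≤ 2ℚ + M * (a * a) * (ℕtoℚ j * ℕtoℚ j)
  [1+a]^j+[1-a]^j≤2+Ma²j² zero    _      =
    ≤-reflexive (sym (trans (cong (2ℚ +_) (ℚP.*-zeroʳ (M * (a * a)))) (ℚP.+-identityʳ 2ℚ)))
  [1+a]^j+[1-a]^j≤2+Ma²j² (suc j) u′≤M = begin
    (1ℚ + a) * u + (1ℚ - a) * v                        ≡⟨ step a u v ⟩
    (u + v) + a * (u - v)                              ≤⟨ +-mono-≤ even (*-monoˡ-≤ 0≤a odd) ⟩
    2ℚ + M * (a * a) * (J * J) + a * (2ℚ * M * a * J)  ≤⟨ p≤p+q (*-nonNeg 0≤M (*-nonNeg 0≤a 0≤a)) ⟩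
    2ℚ + M * (a * a) * (J * J) + a * (2ℚ * M * a * J) + M * (a * a)
                                                       ≡⟨ collect a M J ⟩
    2ℚ + M * (a * a) * ((1ℚ + J) * (1ℚ + J))           ≡⟨ cong (λ t → 2ℚ + M * (a * a) * (t * t)) (ℕtoℚ-suc j) ⟨
    2ℚ + M * (a * a) * (ℕtoℚ (suc j) * ℕtoℚ (suc j))   ∎
    where
    open ℚP.≤-Reasoning
    u = (1ℚ + a) ^ j
    v = (1ℚ - a) ^ j
    J = ℕtoℚ j
    u≤M = [1+a]^j≤M j u′≤M
    0≤M = ≤-trans (^-nonNeg 0≤1+a j) u≤M
    even = [1+a]^j+[1-a]^j≤2+Ma²j² j u≤M
    odd = [1+a]^j-[1-a]^j≤2Maj j u≤M
    step : ∀ a u v → (1ℚ + a) * u + (1ℚ - a) * v ≡ (u + v) + a * (u - v)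
    step = solve 3 (λ a u v → (con 1ℚ :+ a) :* u :+ (con 1ℚ :- a) :* v := (u :+ v) :+ a :* (u :- v)) refl
    collect : ∀ a M J → 2ℚ + M * (a * a) * (J * J) + a * (2ℚ * M * a * J) + M * (a * a)
                        ≡ 2ℚ + M * (a * a) * ((1ℚ + J) * (1ℚ + J))
    collect = solve 3 (λ a M J →
      con 2ℚ :+ M :* (a :* a) :* (J :* J) :+ a :* (con 2ℚ :* M :* a :* J) :+ M :* (a :* a)
        := con 2ℚ :+ M :* (a :* a) :* ((con 1ℚ :+ J) :* (con 1ℚ :+ J))) refl

sumℚ-++ : (xs ys : List ℚ) → sumℚ (xs ++ ys) ≡ sumℚ xs + sumℚ ys
sumℚ-++ []       ys = sym (ℚP.+-identityˡ (sumℚ ys))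
sumℚ-++ (x ∷ xs) ys = trans (cong (x +_) (sumℚ-++ xs ys)) (sym (ℚP.+-assoc x (sumℚ xs) (sumℚ ys)))

module _ {A : Set} where

  sumℚ-map-+ : (f g : A → ℚ) (xs : List A) →
    sumℚ (map (λ z → f z + g z) xs) ≡ sumℚ (map f xs) + sumℚ (map g xs)
  sumℚ-map-+ f g []       = refl
  sumℚ-map-+ f g (x ∷ xs) = trans (cong (f x + g x +_) (sumℚ-map-+ f g xs))
    (+-Comm.interchange (f x) (g x) (sumℚ (map f xs)) (sumℚ (map g xs)))

  sumℚ-map-*ˡ : (c : ℚ) (f : A → ℚ) (xs : List A) →
    sumℚ (map (λ z → c * f z) xs) ≡ c * sumℚ (map f xs)
  sumℚ-map-*ˡ c f []       = sym (ℚP.*-zeroʳ c)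
  sumℚ-map-*ˡ c f (x ∷ xs) =
    trans (cong (c * f x +_) (sumℚ-map-*ˡ c f xs)) (sym (ℚP.*-distribˡ-+ c (f x) _))

sumOver : (k : ℕ) → (Vec Reply k → ℚ) → ℚ
sumOver k f = sumℚ (map f (allReplies k))

sumOver-suc : ∀ k (f : Vec Reply (suc k) → ℚ) →
  sumOver (suc k) f ≡ sumOver k (λ s → f (true ∷ s)) + sumOver k (λ s → f (false ∷ s))
sumOver-suc k f = begin
  sumℚ (map f (map (true ∷_) R ++ map (false ∷_) R))
    ≡⟨ cong sumℚ (map-++ f (map (true ∷_) R) _) ⟩
  sumℚ (map f (map (true ∷_) R) ++ map f (map (false ∷_) R))
    ≡⟨ sumℚ-++ (map f (map (true ∷_) R)) _ ⟩
  sumℚ (map f (map (true ∷_) R)) + sumℚ (map f (map (false ∷_) R))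
    ≡⟨ cong₂ _+_ (cong sumℚ (map-∘ R)) (cong sumℚ (map-∘ R)) ⟨
  sumOver k (λ s → f (true ∷ s)) + sumOver k (λ s → f (false ∷ s))
    ∎
  where
  open ≡-Reasoning
  R = allReplies k

weight : ℚ → ℚ → ∀ {k} → Vec Reply k → ℚ
weight a b []          = 1ℚ
weight a b (true ∷ s)  = a * weight a b s
weight a b (false ∷ s) = b * weight a b s

sumOver-weight : ∀ a b k → sumOver k (weight a b) ≡ (a + b) ^ k
sumOver-weight a b zero    = refl
sumOver-weight a b (suc k) = begin
  sumOver (suc k) (weight a b)
    ≡⟨ sumOver-suc k (weight a b) ⟩
  sumOver k (λ s → a * weight a b s) + sumOver k (λ s → b * weight a b s)
    ≡⟨ cong₂ _+_ (sumℚ-map-*ˡ a (weight a b) (allReplies k)) (sumℚ-map-*ˡ b (weight a b) (allReplies k)) ⟩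
  a * sumOver k (weight a b) + b * sumOver k (weight a b)
    ≡⟨ cong (λ t → a * t + b * t) (sumOver-weight a b k) ⟩
  a * (a + b) ^ k + b * (a + b) ^ k
    ≡⟨ ℚP.*-distribʳ-+ ((a + b) ^ k) a b ⟨
  (a + b) * (a + b) ^ k
    ∎
  where open ≡-Reasoning

weight-counts : ∀ a b {k} (s : Vec Reply k) → a ^ countLt s * b ^ countGt s ≡ weight a b s
weight-counts a b []          = refl
weight-counts a b (true ∷ s)  = trans (ℚP.*-assoc a _ _) (cong (a *_) (weight-counts a b s))
weight-counts a b (false ∷ s) =
  trans (*-Comm.x∙yz≈y∙xz (a ^ countLt s) b (b ^ countGt s)) (cong (b *_) (weight-counts a b s))

weight-* : ∀ a b c d {k} (s : Vec Reply k) → weight a b s * weight c d s ≡ weight (a * c) (b * d) s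
weight-* a b c d []          = refl
weight-* a b c d (true ∷ s)  =
  trans (*-Comm.interchange a (weight a b s) c (weight c d s)) (cong (a * c *_) (weight-* a b c d s))
weight-* a b c d (false ∷ s) =
  trans (*-Comm.interchange b (weight a b s) d (weight c d s)) (cong (b * d *_) (weight-* a b c d s))

seqProb-true : ∀ p {k} (s : Vec Reply k) → seqProb p true s ≡ weight (1ℚ - p) p s
seqProb-true p []          = refl
seqProb-true p (true ∷ s)  = cong ((1ℚ - p) *_) (seqProb-true p s)
seqProb-true p (false ∷ s) = cong (p *_) (seqProb-true p s)

seqProb-false : ∀ p {k} (s : Vec Reply k) → seqProb p false s ≡ weight p (1ℚ - p) s
seqProb-false p []          = refl
seqProb-false p (true ∷ s)  = cong (p *_) (seqProb-false p s)
seqProb-false p (false ∷ s) = cong ((1ℚ - p) *_) (seqProb-false p s)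

coupledUpdate-weight : ∀ p W {k} (s : Vec Reply k) →
  coupledUpdate p W s ≡ W * ((weight (1ℚ - p) p s + weight p (1ℚ - p) s) * ½)
coupledUpdate-weight p W s = cong (λ t → W * (t * ½)) (cong₂ _+_
  (weight-counts (1ℚ - p) p s)
  (trans (ℚP.*-comm ((1ℚ - p) ^ countGt s) (p ^ countLt s)) (weight-counts p (1ℚ - p) s)))

expectedW-weight : ∀ p c W k u v → (∀ (s : Vec Reply k) → seqProb p c s ≡ weight u v s) →
  expectedW p c W k ≡ W * ½ * ((u * (1ℚ - p) + v * p) ^ k + (u * p + v * (1ℚ - p)) ^ k)
expectedW-weight p c W k u v seqProb≡weight = begin
  sumOver k (λ s → seqProb p c s * coupledUpdate p W s)
    ≡⟨ cong sumℚ (map-cong term (allReplies k)) ⟩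
  sumOver k (λ s → W * ½ * weight A₁ B₁ s + W * ½ * weight A₂ B₂ s)
    ≡⟨ sumℚ-map-+ (λ s → W * ½ * weight A₁ B₁ s) (λ s → W * ½ * weight A₂ B₂ s) (allReplies k) ⟩
  sumOver k (λ s → W * ½ * weight A₁ B₁ s) + sumOver k (λ s → W * ½ * weight A₂ B₂ s)
    ≡⟨ cong₂ _+_ (sumℚ-map-*ˡ (W * ½) (weight A₁ B₁) (allReplies k))
                 (sumℚ-map-*ˡ (W * ½) (weight A₂ B₂) (allReplies k)) ⟩
  W * ½ * sumOver k (weight A₁ B₁) + W * ½ * sumOver k (weight A₂ B₂)
    ≡⟨ cong₂ (λ x y → W * ½ * x + W * ½ * y) (sumOver-weight A₁ B₁ k) (sumOver-weight A₂ B₂ k) ⟩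
  W * ½ * (A₁ + B₁) ^ k + W * ½ * (A₂ + B₂) ^ k
    ≡⟨ ℚP.*-distribˡ-+ (W * ½) _ _ ⟨
  W * ½ * ((A₁ + B₁) ^ k + (A₂ + B₂) ^ k)
    ∎
  where
  open ≡-Reasoning
  q  = 1ℚ - p
  A₁ = u * q
  B₁ = v * p
  A₂ = u * p
  B₂ = v * q
  distribute : ∀ x y z W → x * (W * ((y + z) * ½)) ≡ W * ½ * (x * y) + W * ½ * (x * z)
  distribute = solve 4 (λ x y z W →
    x :* (W :* ((y :+ z) :* con ½)) := W :* con ½ :* (x :* y) :+ W :* con ½ :* (x :* z)) refl
  term : ∀ s → seqProb p c s * coupledUpdate p W s ≡ W * ½ * weight A₁ B₁ s + W * ½ * weight A₂ B₂ s
  term s = begin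
    seqProb p c s * coupledUpdate p W s
      ≡⟨ cong₂ _*_ (seqProb≡weight s) (coupledUpdate-weight p W s) ⟩
    weight u v s * (W * ((weight q p s + weight p q s) * ½))
      ≡⟨ distribute (weight u v s) _ _ W ⟩
    W * ½ * (weight u v s * weight q p s) + W * ½ * (weight u v s * weight p q s)
      ≡⟨ cong₂ (λ x y → W * ½ * x + W * ½ * y) (weight-* u v q p s) (weight-* u v p q s) ⟩
    W * ½ * weight A₁ B₁ s + W * ½ * weight A₂ B₂ s
      ∎

halve-powers : ∀ W U V k → W * ½ * ((½ * U) ^ k + (½ * V) ^ k) ≡ ½ ^ k * (½ * (U ^ k + V ^ k)) * W
halve-powers W U V k = trans
  (cong₂ (λ x y → W * ½ * (x + y)) (^-distribʳ-* ½ U k) (^-distribʳ-* ½ V k))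
  (regroup W (½ ^ k) (U ^ k) (V ^ k))
  where
  regroup : ∀ W h u v → W * ½ * (h * u + h * v) ≡ h * (½ * (u + v)) * W
  regroup = solve 4 (λ W h u v → W :* con ½ :* (h :* u :+ h :* v) := h :* (con ½ :* (u :+ v)) :* W) refl

sum-of-squares : ∀ ε → (1ℚ - (½ - ε)) * (1ℚ - (½ - ε)) + (½ - ε) * (½ - ε) ≡ ½ * (1ℚ + 2ℚ * 2ℚ * (ε * ε))
sum-of-squares = solve 1 (λ ε →
  (con 1ℚ :- (con ½ :- ε)) :* (con 1ℚ :- (con ½ :- ε)) :+ (con ½ :- ε) :* (con ½ :- ε)
    := con ½ :* (con 1ℚ :+ con 2ℚ :* con 2ℚ :* (ε :* ε))) refl

twice-product : ∀ ε → (1ℚ - (½ - ε)) * (½ - ε) + (½ - ε) * (1ℚ - (½ - ε)) ≡ ½ * (1ℚ - 2ℚ * 2ℚ * (ε * ε))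
twice-product = solve 1 (λ ε →
  (con 1ℚ :- (con ½ :- ε)) :* (con ½ :- ε) :+ (con ½ :- ε) :* (con 1ℚ :- (con ½ :- ε))
    := con ½ :* (con 1ℚ :- con 2ℚ :* con 2ℚ :* (ε :* ε))) refl

expectedW-closed : ∀ ε c W k → expectedW (½ - ε) c W k ≡
  ½ ^ k * (½ * ((1ℚ + 2ℚ * 2ℚ * (ε * ε)) ^ k + (1ℚ - 2ℚ * 2ℚ * (ε * ε)) ^ k)) * W
expectedW-closed ε true W k = begin
  expectedW p true W k
    ≡⟨ expectedW-weight p true W k q p (seqProb-true p) ⟩
  W * ½ * ((q * q + p * p) ^ k + (q * p + p * q) ^ k)
    ≡⟨ cong₂ (λ x y → W * ½ * (x ^ k + y ^ k)) (sum-of-squares ε) (twice-product ε) ⟩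
  W * ½ * ((½ * U) ^ k + (½ * V) ^ k)
    ≡⟨ halve-powers W U V k ⟩
  ½ ^ k * (½ * (U ^ k + V ^ k)) * W
    ∎
  where
  open ≡-Reasoning
  p = ½ - ε
  q = 1ℚ - p
  U = 1ℚ + 2ℚ * 2ℚ * (ε * ε)
  V = 1ℚ - 2ℚ * 2ℚ * (ε * ε)
expectedW-closed ε false W k = begin
  expectedW p false W k
    ≡⟨ expectedW-weight p false W k p q (seqProb-false p) ⟩
  W * ½ * ((p * q + q * p) ^ k + (p * p + q * q) ^ k)
    ≡⟨ cong₂ (λ x y → W * ½ * (x ^ k + y ^ k))
             (trans (ℚP.+-comm (p * q) (q * p)) (twice-product ε))
             (trans (ℚP.+-comm (p * p) (q * q)) (sum-of-squares ε)) ⟩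
  W * ½ * ((½ * V) ^ k + (½ * U) ^ k)
    ≡⟨ halve-powers W V U k ⟩
  ½ ^ k * (½ * (V ^ k + U ^ k)) * W
    ≡⟨ cong (λ t → ½ ^ k * (½ * t) * W) (ℚP.+-comm (V ^ k) (U ^ k)) ⟩
  ½ ^ k * (½ * (U ^ k + V ^ k)) * W
    ∎
  where
  open ≡-Reasoning
  p = ½ - ε
  q = 1ℚ - p
  U = 1ℚ + 2ℚ * 2ℚ * (ε * ε)
  V = 1ℚ - 2ℚ * 2ℚ * (ε * ε)

expectedW-≤ : ∀ {ε M W} → 0ℚ ≤ ε → ε ≤ ½ → 0ℚ ≤ W → ∀ c k → (1ℚ + 2ℚ * 2ℚ * (ε * ε)) ^ k ≤ M →
  expectedW (½ - ε) c W k ≤ ½ ^ k * (1ℚ + 2ℚ * 2ℚ * 2ℚ * M * ε ^ 4 * ℕtoℚ k ^ 2) * W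
expectedW-≤ {ε} {M} {W} 0≤ε ε≤½ 0≤W c k [1+a]^k≤M = begin
  expectedW (½ - ε) c W k                                   ≡⟨ expectedW-closed ε c W k ⟩
  ½ ^ k * (½ * ((1ℚ + a) ^ k + (1ℚ - a) ^ k)) * W           ≤⟨ *-monoʳ-≤ 0≤W (*-monoˡ-≤ (^-nonNeg 0≤½ k) ½even≤) ⟩
  ½ ^ k * (½ * (2ℚ + M * (a * a) * (ℕtoℚ k * ℕtoℚ k))) * W  ≡⟨ simplify (½ ^ k) M ε (ℕtoℚ k) W ⟩
  ½ ^ k * (1ℚ + 2ℚ * 2ℚ * 2ℚ * M * ε ^ 4 * ℕtoℚ k ^ 2) * W  ∎
  where
  open ℚP.≤-Reasoning
  a = 2ℚ * 2ℚ * (ε * ε)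
  0≤4 : 0ℚ ≤ 2ℚ * 2ℚ
  0≤4 = *-nonNeg 0≤2 0≤2
  0≤a : 0ℚ ≤ a
  0≤a = *-nonNeg 0≤4 (*-nonNeg 0≤ε 0≤ε)
  a≤1 : a ≤ 1ℚ
  a≤1 = *-monoˡ-≤ 0≤4 (*-mono-≤ 0≤ε 0≤ε ε≤½ ε≤½)
  ½even≤ = *-monoˡ-≤ 0≤½ ([1+a]^j+[1-a]^j≤2+Ma²j² 0≤a a≤1 k [1+a]^k≤M)
  simplify : ∀ h M e κ W →
    h * (½ * (2ℚ + M * (2ℚ * 2ℚ * (e * e) * (2ℚ * 2ℚ * (e * e))) * (κ * κ))) * W
      ≡ h * (1ℚ + 2ℚ * 2ℚ * 2ℚ * M * (e * (e * (e * (e * 1ℚ)))) * (κ * (κ * 1ℚ))) * W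
  simplify = solve 5 (λ h M e κ W →
    h :* (con ½ :* (con 2ℚ :+ M :* (con 2ℚ :* con 2ℚ :* (e :* e) :* (con 2ℚ :* con 2ℚ :* (e :* e))) :* (κ :* κ))) :* W
      := h :* (con 1ℚ :+ con 2ℚ :* con 2ℚ :* con 2ℚ :* M :* (e :* (e :* (e :* (e :* con 1ℚ)))) :* (κ :* (κ :* con 1ℚ)))
           :* W) refl

lemma9 : (K : ℚ) → ∃ λ (C : ℚ) →
           (ε : ℚ) → 0ℚ < ε → ε < ½ →
           (k : ℕ) → ℕtoℚ k * (ε * ε) ≤ K →
           (c : Bool) (W : ℚ) → 0ℚ ≤ W →
           expectedW (½ - ε) c W k ≤ (½ ^ k) * (1ℚ + C * (ε ^ 4) * (ℕtoℚ k ^ 2)) * W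
lemma9 K with ℕtoℚ-unbounded K
... | N , K≤N = 2ℚ * 2ℚ * 2ℚ * 2ℚ ^ (16 ℕ.* suc N) , λ ε 0<ε ε<½ k kε²≤K c W 0≤W →
  let 0≤ε = <⇒≤ 0<ε
      ε≤½ = <⇒≤ ε<½
      [1+4ε²]^k≤M = [1+4x]^k≤2^[16*[1+N]] (*-nonNeg 0≤ε 0≤ε) (*-mono-≤ 0≤ε 0≤ε ε≤½ ε≤½) k N (≤-trans kε²≤K K≤N)
  in expectedW-≤ 0≤ε ε≤½ 0≤W c k [1+4ε²]^k≤M
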